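{- Let $g$ be a normalized arithmetic function and let $1\le m<n$ be integers. Let $A_{n,m}^{g,1}$ be the coefficient of $x^m$ in $P_n^{g,1}(x)$. Then $$A_{n,m}^{g,1}=\sum_{\mu\vdash n-m}\mathcal{G}(\mu)\,\frac{\ell(\mu)!}{\prod_{j\ge1}\mathfrak{m}_j(\mu)!}\,\binom{n-|\mu|}{\ell(\mu)},$$ where the sum runs over all partitions $\mu$ of $n-m$.
   Context: An arithmetic function is a map $f:\mathbb{N}=\{1,2,\dots\}\to\mathbb{C}$; it is normalized if $f(1)=1$. For a normalized arithmetic function $g$ define polynomials $P_0^{g,1}(x):=1$ and, for $n\ge1$, $P_n^{g,1}(x):=x\sum_{k=1}^n g(k)P_{n-k}^{g,1}(x)$ (this is the recursion $P_n^{g,h}(x)=\frac{x}{h(n)}\sum_{k=1}^n g(k)P^{g,h}_{n-k}(x)$ with $h\equiv1$). Write $P_n^{g,1}(x)=\sum_{m=0}^n A^{g,1}_{n,m}x^m$. For a partition $\mu=(\mu_1,\dots,\mu_r)$ (non-increasing positive integers), $\ell(\mu)=r$ is its length, $|\mu|=\sum\mu_i$ its size, $\mathfrak{m}_j(\mu)=|\{i:\mu_i=j\}|$ the multiplicity of $j$, and $\mathcal{G}(\mu):=\prod_{k=1}^{r}g(\mu_k+1)$; $\mu\vdash N$ means $|\mu|=N$. -}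

module Defs where

open import Level using (Level)
open import Data.Nat using (ℕ; zero; suc; _∸_; _⊓_; NonZero; _!) renaming (_+_ to _+ℕ_; _*_ to _*ℕ_)
open import Data.Nat.Properties using (_!≢0; m*n≢0)
open import Data.Nat.ListAction using (sum)
open import Data.Nat.DivMod using (_/_)
open import Data.Nat.Combinatorics using (_C_)
open import Data.List using (List; []; _∷_; map; concatMap; upTo; length; foldr)
open import Data.Bool using (if_then_else_)
open import Algebra.Bundles using (CommutativeRing)

-- Integer partitions, written as non-increasing lists of positive naturals.

-- go f k N : all partitions of N whose parts are all ≤ k (fuel f ≥ N),
-- each listed in non-increasing order.
partitionsGo : ℕ → ℕ → ℕ → List (List ℕ)
partitionsGo _       _ zero    = [] ∷ []
partitionsGo zero    _ (suc _) = []
partitionsGo (suc f) k (suc N) =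
  concatMap (λ j → map (j ∷_) (partitionsGo f j (suc N ∸ j)))
            (map suc (upTo (k ⊓ suc N)))

partitions : ℕ → List (List ℕ)
partitions N = partitionsGo N N N

len : List ℕ → ℕ
len = length

size : List ℕ → ℕ
size = sum

mult : ℕ → List ℕ → ℕ
mult j []      = 0
mult j (x ∷ μ) = (if Data.Nat._≡ᵇ_ j x then 1 else 0) +ℕ mult j μ

multFactProd : ℕ → List ℕ → ℕ
multFactProd zero    μ = 1
multFactProd (suc B) μ = (mult (suc B) μ) ! *ℕ multFactProd B μ

multFactProd≢0 : ∀ B μ → NonZero (multFactProd B μ)
multFactProd≢0 zero    μ = _
multFactProd≢0 (suc B) μ =
  m*n≢0 (mult (suc B) μ !) (multFactProd B μ)
    {{(mult (suc B) μ) !≢0}} {{multFactProd≢0 B μ}}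

-- ℓ(μ)! / ∏_{j≥1} 𝔪_j(μ)!   (multiplicities 𝔪_j(μ) vanish for j > |μ|,
-- so the product over j ≥ 1 equals the product over 1 ≤ j ≤ |μ|)
multinomial : List ℕ → ℕ
multinomial μ = _/_ (len μ !) (multFactProd (size μ) μ) {{multFactProd≢0 (size μ) μ}}

-- Everything over a commutative ring R (stand-in for ℂ).

module WithRing {c ℓ : Level} (R : CommutativeRing c ℓ) where
  open CommutativeRing R

  _·_ : ℕ → Carrier → Carrier
  zero  · x = 0#
  suc n · x = x + (n · x)

  -- polynomials over R as coefficient sequences (coefficient of x^m at m)
  Poly : Set c
  Poly = ℕ → Carrier

  0ₚ : Poly
  0ₚ _ = 0#

  1ₚ : Poly
  1ₚ zero    = 1#
  1ₚ (suc _) = 0#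

  _+ₚ_ : Poly → Poly → Poly
  (p +ₚ q) m = p m + q m

  _*ₛ_ : Carrier → Poly → Poly
  (a *ₛ p) m = a * p m

  xₚ* : Poly → Poly
  xₚ* p zero    = 0#
  xₚ* p (suc m) = p m

  module _ (g : ℕ → Carrier) where
    weightedSum : ℕ → List Poly → Poly
    weightedSum o []      = 0ₚ
    weightedSum o (p ∷ L) = (g (suc o) *ₛ p) +ₚ weightedSum (suc o) L

    -- Ps n = P_n ∷ P_{n-1} ∷ … ∷ P_0   (P = P^{g,1})
    Ps : ℕ → List Poly
    Ps zero    = 1ₚ ∷ []
    Ps (suc n) = xₚ* (weightedSum 0 (Ps n)) ∷ Ps n
      -- P_{n+1} = x · Σ_{k=1}^{n+1} g(k) P_{n+1-k}

    P : ℕ → Poly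
    P n with Ps n
    ... | []    = 0ₚ   -- unreachable
    ... | p ∷ _ = p

    A : ℕ → ℕ → Carrier
    A n m = P n m

    𝒢 : List ℕ → Carrier
    𝒢 = foldr (λ k r → g (suc k) * r) 1#

    term : ℕ → List ℕ → Carrier
    term n μ = ((multinomial μ *ℕ ((n ∸ size μ) C len μ)) · 𝒢 μ)

    RHS : ℕ → ℕ → Carrier
    RHS n m = foldr (λ μ r → term n μ + r) 0# (partitions (n ∸ m))

{-# OPTIONS --safe #-}
module Submission where

open import Defs
open import Level using (Level)
open import Data.Nat using (ℕ; _≤_; _<_)
open import Data.Nat.Properties using (<⇒≤)
open import Algebra.Bundles using (CommutativeRing)

-- As formal power series Σₙ Pₙ tⁿ = 1/(1 − x t G(t)) with G(t) = Σ_{i≥0} g(i+1) tⁱ, so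
-- A_{n,m} is the coefficient of t^{n−m} in G(t)ᵐ; this is checked directly on the recursion.
-- As g(1) = 1, G(t)ᵐ = (1 + Σ_{j≥1} g(j+1) tʲ)ᵐ, and a partition μ ⊢ n − m contributes
-- 𝒢(μ) once for each way of placing its parts among the m factors, that is
-- m!/((m − ℓ(μ))! ∏ⱼ 𝔪ⱼ(μ)!) = ℓ(μ)!/∏ⱼ 𝔪ⱼ(μ)! · C(m, ℓ(μ)) times, where m = n − |μ|.
-- The expansion is carried out one part size at a time, following the enumeration of
-- partitions by their largest part.

module Counting where

  open import Data.Bool using (true; false; T)
  open import Data.Unit using (⊤; tt)
  open import Data.Nat
  open import Data.Nat.Properties
  open import Data.Nat.ListAction using (sum)
  open import Data.Nat.DivMod using (_/_; m/n*n≡m; m*n/n≡m)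
  open import Data.Nat.Combinatorics using (_C_; nCk≡n!/k![n-k]!; k>n⇒nCk≡0; k![n∸k]!∣n!; nCn≡1)
  open import Data.Nat.Tactic.RingSolver using (solve-∀)
  open import Data.List using (List; []; _∷_; map; concatMap; upTo; concat; length; _++_; [_]; replicate)
  open import Data.List.Properties using (map-∘; map-cong; upTo-∷ʳ; map-++; concatMap-++; ++-identityʳ)
  open import Data.List.Relation.Unary.All as All using (All; []; _∷_)
  import Data.List.Relation.Unary.All.Properties as All
  open import Data.Product using (_×_; _,_)
  open import Function using (_∘_; id)
  open import Relation.Binary.PropositionalEquality hiding ([_])
  open import Relation.Nullary using (yes; no)
  open import Relation.Nullary.Negation using (contradiction)

  -- Partitions

  partitionsGo-fuel : ∀ f f′ k N → N ≤ f → N ≤ f′ → partitionsGo f k N ≡ partitionsGo f′ k N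
  partitionsGo-fuel f f′ k zero _ _ = refl
  partitionsGo-fuel (suc f) (suc f′) k (suc N) (s≤s N≤f) (s≤s N≤f′) =
    cong concat (map-cong-upTo (λ j → cong (map (suc j ∷_)) (partitionsGo-fuel f f′ (suc j) (N ∸ j)
      (≤-trans (m∸n≤m N j) N≤f) (≤-trans (m∸n≤m N j) N≤f′))))
    where
    map-cong-upTo : ∀ {F F′ : ℕ → List (List ℕ)} → (∀ j → F (suc j) ≡ F′ (suc j)) →
                    map F (map suc (upTo (k ⊓ suc N))) ≡ map F′ (map suc (upTo (k ⊓ suc N)))
    map-cong-upTo {F} {F′} F≗F′ = begin
      map F (map suc (upTo (k ⊓ suc N)))  ≡⟨ map-∘ (upTo (k ⊓ suc N)) ⟨
      map (F ∘ suc) (upTo (k ⊓ suc N))    ≡⟨ map-cong F≗F′ (upTo (k ⊓ suc N)) ⟩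
      map (F′ ∘ suc) (upTo (k ⊓ suc N))   ≡⟨ map-∘ (upTo (k ⊓ suc N)) ⟩
      map F′ (map suc (upTo (k ⊓ suc N))) ∎
      where open ≡-Reasoning

  concatMap-upTo-suc : ∀ {A : Set} (F : ℕ → List A) n →
    concatMap F (map suc (upTo (suc n))) ≡ concatMap F (map suc (upTo n)) ++ F (suc n)
  concatMap-upTo-suc F n = begin
    concatMap F (map suc (upTo (suc n)))                ≡⟨ cong (concatMap F ∘ map suc) (upTo-∷ʳ n) ⟨
    concatMap F (map suc (upTo n ++ [ n ]))             ≡⟨ cong (concatMap F) (map-++ suc (upTo n) [ n ]) ⟩
    concatMap F (map suc (upTo n) ++ [ suc n ])         ≡⟨ concatMap-++ F (map suc (upTo n)) [ suc n ] ⟩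
    concatMap F (map suc (upTo n)) ++ (F (suc n) ++ []) ≡⟨ cong (concatMap F (map suc (upTo n)) ++_) (++-identityʳ (F (suc n))) ⟩
    concatMap F (map suc (upTo n)) ++ F (suc n)         ∎
    where open ≡-Reasoning

  NonIncreasing≤ : ℕ → List ℕ → Set
  NonIncreasing≤ x []      = ⊤
  NonIncreasing≤ x (y ∷ ν) = 1 ≤ y × y ≤ x × NonIncreasing≤ y ν

  partitionsGo-sound : ∀ f k N → All (λ μ → NonIncreasing≤ k μ × sum μ ≡ N) (partitionsGo f k N)
  partitionsGo-sound f       k zero    = (tt , refl) ∷ []
  partitionsGo-sound zero    k (suc N) = []
  partitionsGo-sound (suc f) k (suc N) =
    All.concat⁺ (All.map⁺ (All.map⁺ (All.applyUpTo⁺₁ id (k ⊓ suc N) λ {j} j< →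
      All.map⁺ (All.map (λ (ν≤ , Σν) → (s≤s z≤n , ≤-trans j< (m⊓n≤m k (suc N)) , ν≤) ,
                                       trans (cong (suc j +_) Σν) (m+[n∸m]≡n (≤-trans j< (m⊓n≤n k (suc N)))))
                        (partitionsGo-sound f (suc j) (N ∸ j))))))

  -- Multiplicities and placements

  mult-head-≡ : ∀ x L → mult x (x ∷ L) ≡ suc (mult x L)
  mult-head-≡ x L with x ≡ᵇ x in eq
  ... | true  = refl
  ... | false = contradiction (subst T eq (≡⇒≡ᵇ x x refl)) λ ()

  mult-head-≢ : ∀ j x L → j ≢ x → mult j (x ∷ L) ≡ mult j L
  mult-head-≢ j x L j≢x with j ≡ᵇ x in eq
  ... | false = refl
  ... | true  = contradiction (≡ᵇ⇒≡ j x (subst T (sym eq) tt)) j≢x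

  mult-replicate-≡ : ∀ x a L → mult x (replicate a x ++ L) ≡ a + mult x L
  mult-replicate-≡ x zero    L = refl
  mult-replicate-≡ x (suc a) L =
    trans (mult-head-≡ x (replicate a x ++ L)) (cong suc (mult-replicate-≡ x a L))

  mult-replicate-≢ : ∀ j x a L → j ≢ x → mult j (replicate a x ++ L) ≡ mult j L
  mult-replicate-≢ j x zero    L j≢x = refl
  mult-replicate-≢ j x (suc a) L j≢x =
    trans (mult-head-≢ j x (replicate a x ++ L) j≢x) (mult-replicate-≢ j x a L j≢x)

  NonIncreasing≤⇒mult≡0 : ∀ x y ν → NonIncreasing≤ y ν → y < x → mult x ν ≡ 0
  NonIncreasing≤⇒mult≡0 x y []      _                y<x = refl
  NonIncreasing≤⇒mult≡0 x y (z ∷ ν) (_ , z≤y , ν≤z) y<x =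
    trans (mult-head-≢ x z ν (λ x≡z → <-irrefl (sym x≡z) z<x)) (NonIncreasing≤⇒mult≡0 x z ν ν≤z z<x)
    where z<x = ≤-<-trans z≤y y<x

  multFactProd-[] : ∀ B → multFactProd B [] ≡ 1
  multFactProd-[] zero    = refl
  multFactProd-[] (suc B) = trans (+-identityʳ (multFactProd B [])) (multFactProd-[] B)

  multFactProd-replicate-> : ∀ B x a L → B < x → multFactProd B (replicate a x ++ L) ≡ multFactProd B L
  multFactProd-replicate-> zero    x a L B<x = refl
  multFactProd-replicate-> (suc B) x a L B<x =
    cong₂ (λ u v → u ! * v) (mult-replicate-≢ (suc B) x a L (λ B≡x → <-irrefl B≡x B<x))
                            (multFactProd-replicate-> B x a L (<-trans (n<1+n B) B<x))

  multFactProd-replicate : ∀ B x a L → 1 ≤ x → x ≤ B → mult x L ≡ 0 →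
                           multFactProd B (replicate a x ++ L) ≡ a ! * multFactProd B L
  multFactProd-replicate zero    (suc x) a L _ () _
  multFactProd-replicate (suc B) x a L 1≤x x≤B x∉L with x ≟ suc B
  ... | yes refl = begin
    mult x (replicate a x ++ L) ! * multFactProd B (replicate a x ++ L)
      ≡⟨ cong₂ (λ u v → u ! * v) (trans (mult-replicate-≡ x a L) (cong (a +_) x∉L))
                                 (multFactProd-replicate-> B x a L ≤-refl) ⟩
    (a + 0) ! * multFactProd B L
      ≡⟨ cong (λ u → u ! * multFactProd B L) (+-identityʳ a) ⟩
    a ! * multFactProd B L
      ≡⟨ cong (a ! *_) (*-identityˡ (multFactProd B L)) ⟨
    a ! * (0 ! * multFactProd B L)
      ≡⟨ cong (λ u → a ! * (u ! * multFactProd B L)) x∉L ⟨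
    a ! * (mult x L ! * multFactProd B L) ∎
    where open ≡-Reasoning
  ... | no x≢1+B = begin
    mult (suc B) (replicate a x ++ L) ! * multFactProd B (replicate a x ++ L)
      ≡⟨ cong₂ (λ u v → u ! * v) (mult-replicate-≢ (suc B) x a L (x≢1+B ∘ sym))
                                 (multFactProd-replicate B x a L 1≤x (≤-pred (≤∧≢⇒< x≤B x≢1+B)) x∉L) ⟩
    mult (suc B) L ! * (a ! * multFactProd B L)
      ≡⟨ x*[y*z]≡y*[x*z] (mult (suc B) L !) (a !) (multFactProd B L) ⟩
    a ! * (mult (suc B) L ! * multFactProd B L) ∎
    where
    open ≡-Reasoning
    x*[y*z]≡y*[x*z] : ∀ x y z → x * (y * z) ≡ y * (x * z)
    x*[y*z]≡y*[x*z] = solve-∀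

  nCk*[k!*[n∸k]!]≡n! : ∀ {n k} → k ≤ n → (n C k) * (k ! * (n ∸ k) !) ≡ n !
  nCk*[k!*[n∸k]!]≡n! {n} {k} k≤n =
    trans (cong (_* (k ! * (n ∸ k) !)) (nCk≡n!/k![n-k]! k≤n))
          (m/n*n≡m {{k !* (n ∸ k) !≢0}} (k![n∸k]!∣n! k≤n))

  -- the falling factorials satisfy n^(a) (n − a)^(b) = n^(a+b)
  [nCa*a!]*[[n∸a]Cb*b!]≡nC[a+b]*[a+b]! : ∀ n a b →
    ((n C a) * a !) * (((n ∸ a) C b) * b !) ≡ (n C (a + b)) * (a + b) !
  [nCa*a!]*[[n∸a]Cb*b!]≡nC[a+b]*[a+b]! n a b with a ≤? n | b ≤? n ∸ a
  ... | no a≰n | _ = begin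
    ((n C a) * a !) * (((n ∸ a) C b) * b !) ≡⟨ cong (λ u → (u * a !) * (((n ∸ a) C b) * b !)) (k>n⇒nCk≡0 (≰⇒> a≰n)) ⟩
    0                                       ≡⟨ cong (_* (a + b) !) (k>n⇒nCk≡0 (<-≤-trans (≰⇒> a≰n) (m≤m+n a b))) ⟨
    (n C (a + b)) * (a + b) !               ∎
    where open ≡-Reasoning
  ... | yes _ | no b≰n∸a = begin
    ((n C a) * a !) * (((n ∸ a) C b) * b !) ≡⟨ cong (λ u → ((n C a) * a !) * (u * b !)) (k>n⇒nCk≡0 (≰⇒> b≰n∸a)) ⟩
    ((n C a) * a !) * 0                     ≡⟨ *-zeroʳ ((n C a) * a !) ⟩
    0                                       ≡⟨ cong (_* (a + b) !) (k>n⇒nCk≡0 (≰⇒> a+b≰n)) ⟨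
    (n C (a + b)) * (a + b) !               ∎
    where
    open ≡-Reasoning
    a+b≰n : a + b ≰ n
    a+b≰n a+b≤n = b≰n∸a (subst (_≤ n ∸ a) (m+n∸m≡n a b) (∸-monoˡ-≤ a a+b≤n))
  ... | yes a≤n | yes b≤n∸a = *-cancelʳ-≡ _ _ (r !) {{r !≢0}} (begin
    ((n C a) * a !) * (((n ∸ a) C b) * b !) * r !   ≡⟨ reassoc (n C a) (a !) ((n ∸ a) C b) (b !) (r !) ⟩
    (n C a) * (a ! * (((n ∸ a) C b) * (b ! * r !))) ≡⟨ cong (λ u → (n C a) * (a ! * u)) (nCk*[k!*[n∸k]!]≡n! b≤n∸a) ⟩
    (n C a) * (a ! * (n ∸ a) !)                     ≡⟨ nCk*[k!*[n∸k]!]≡n! a≤n ⟩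
    n !                                             ≡⟨ nCk*[k!*[n∸k]!]≡n! a+b≤n ⟨
    (n C (a + b)) * ((a + b) ! * (n ∸ (a + b)) !)   ≡⟨ cong (λ u → (n C (a + b)) * ((a + b) ! * u !)) (∸-+-assoc n a b) ⟨
    (n C (a + b)) * ((a + b) ! * r !)               ≡⟨ *-assoc (n C (a + b)) ((a + b) !) (r !) ⟨
    (n C (a + b)) * (a + b) ! * r !                 ∎)
    where
    open ≡-Reasoning
    r = n ∸ a ∸ b
    a+b≤n : a + b ≤ n
    a+b≤n = subst (_≤ n) (+-comm b a) (subst (b + a ≤_) (m∸n+n≡m a≤n) (+-monoˡ-≤ a b≤n∸a))
    reassoc : ∀ p q s t u → (p * q) * (s * t) * u ≡ p * (q * (s * (t * u)))
    reassoc = solve-∀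

  -- placementsRun m a x ν counts the placements of the parts of replicate a x ++ ν into m
  -- slots, equal parts being indistinguishable: one binomial factor per maximal run of
  -- equal parts.  Hence placements m μ = m! / ((m ∸ ℓ(μ))! ∏ⱼ 𝔪ⱼ(μ)!).
  placementsRun : ℕ → ℕ → ℕ → List ℕ → ℕ
  placementsRun m a x []      = m C a
  placementsRun m a x (y ∷ ν) with y ≟ x
  ... | yes _ = placementsRun m (suc a) x ν
  ... | no  _ = (m C a) * placementsRun (m ∸ a) 1 y ν

  placements : ℕ → List ℕ → ℕ
  placements m []      = 1
  placements m (y ∷ ν) = placementsRun m 1 y ν

  placementsRun-≡ : ∀ m a x ν → placementsRun m a x (x ∷ ν) ≡ placementsRun m (suc a) x ν
  placementsRun-≡ m a x ν with x ≟ x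
  ... | yes _   = refl
  ... | no x≢x = contradiction refl x≢x

  placementsRun-≢ : ∀ m a x y ν → y ≢ x → placementsRun m a x (y ∷ ν) ≡ (m C a) * placementsRun (m ∸ a) 1 y ν
  placementsRun-≢ m a x y ν y≢x with y ≟ x
  ... | yes y≡x = contradiction y≡x y≢x
  ... | no _    = refl

  placementsRun-0 : ∀ m x ν → placementsRun m 0 x ν ≡ placements m ν
  placementsRun-0 m x []      = refl
  placementsRun-0 m x (y ∷ ν) with y ≟ x
  ... | yes refl = refl
  ... | no _     = +-identityʳ (placementsRun m 1 y ν)

  replicate-∷ : ∀ {A : Set} a (x : A) ν → replicate a x ++ x ∷ ν ≡ replicate (suc a) x ++ ν
  replicate-∷ zero    x ν = refl
  replicate-∷ (suc a) x ν = cong (x ∷_) (replicate-∷ a x ν)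

  placementsRun*multFactProd : ∀ m a x ν B → NonIncreasing≤ x ν → 1 ≤ x → x ≤ B →
    placementsRun m a x ν * multFactProd B (replicate a x ++ ν) ≡ (m C (a + length ν)) * (a + length ν) !
  placementsRun*multFactProd m a x [] B _ 1≤x x≤B = begin
    (m C a) * multFactProd B (replicate a x ++ [])
      ≡⟨ cong ((m C a) *_) (multFactProd-replicate B x a [] 1≤x x≤B refl) ⟩
    (m C a) * (a ! * multFactProd B [])
      ≡⟨ cong (λ u → (m C a) * (a ! * u)) (multFactProd-[] B) ⟩
    (m C a) * (a ! * 1)
      ≡⟨ cong ((m C a) *_) (*-identityʳ (a !)) ⟩
    (m C a) * a !
      ≡⟨ cong (λ u → (m C u) * u !) (+-identityʳ a) ⟨
    (m C (a + 0)) * (a + 0) ! ∎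
    where open ≡-Reasoning
  placementsRun*multFactProd m a x (y ∷ ν) B (1≤y , y≤x , ν≤y) 1≤x x≤B with y ≟ x
  ... | yes refl = begin
    placementsRun m (suc a) y ν * multFactProd B (replicate a y ++ y ∷ ν)
      ≡⟨ cong (λ L → placementsRun m (suc a) y ν * multFactProd B L) (replicate-∷ a y ν) ⟩
    placementsRun m (suc a) y ν * multFactProd B (replicate (suc a) y ++ ν)
      ≡⟨ placementsRun*multFactProd m (suc a) y ν B ν≤y 1≤x x≤B ⟩
    (m C (suc a + length ν)) * (suc a + length ν) !
      ≡⟨ cong (λ u → (m C u) * u !) (+-suc a (length ν)) ⟨
    (m C (a + suc (length ν))) * (a + suc (length ν)) ! ∎
    where open ≡-Reasoning
  ... | no y≢x = begin
    (m C a) * placementsRun (m ∸ a) 1 y ν * multFactProd B (replicate a x ++ y ∷ ν)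
      ≡⟨ cong ((m C a) * placementsRun (m ∸ a) 1 y ν *_) (multFactProd-replicate B x a (y ∷ ν) 1≤x x≤B x∉y∷ν) ⟩
    (m C a) * placementsRun (m ∸ a) 1 y ν * (a ! * multFactProd B (y ∷ ν))
      ≡⟨ interchange (m C a) (placementsRun (m ∸ a) 1 y ν) (a !) (multFactProd B (y ∷ ν)) ⟩
    ((m C a) * a !) * (placementsRun (m ∸ a) 1 y ν * multFactProd B (y ∷ ν))
      ≡⟨ cong (((m C a) * a !) *_) (placementsRun*multFactProd (m ∸ a) 1 y ν B ν≤y 1≤y (≤-trans y≤x x≤B)) ⟩
    ((m C a) * a !) * (((m ∸ a) C suc (length ν)) * suc (length ν) !)
      ≡⟨ [nCa*a!]*[[n∸a]Cb*b!]≡nC[a+b]*[a+b]! m a (suc (length ν)) ⟩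
    (m C (a + suc (length ν))) * (a + suc (length ν)) ! ∎
    where
    open ≡-Reasoning
    x∉y∷ν : mult x (y ∷ ν) ≡ 0
    x∉y∷ν = trans (mult-head-≢ x y ν (y≢x ∘ sym)) (NonIncreasing≤⇒mult≡0 x y ν ν≤y (≤∧≢⇒< y≤x y≢x))
    interchange : ∀ p q s t → p * q * (s * t) ≡ (p * s) * (q * t)
    interchange = solve-∀

  placements*multFactProd : ∀ m μ B → NonIncreasing≤ B μ →
    placements m μ * multFactProd B μ ≡ (m C length μ) * length μ !
  placements*multFactProd m []      B _              = trans (+-identityʳ (multFactProd B [])) (multFactProd-[] B)
  placements*multFactProd m (y ∷ ν) B (1≤y , y≤B , ν≤y) = placementsRun*multFactProd m 1 y ν B ν≤y 1≤y y≤B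

  multinomial*C≡placements : ∀ m μ → NonIncreasing≤ (sum μ) μ → multinomial μ * (m C length μ) ≡ placements m μ
  multinomial*C≡placements m μ μ≤ = sym (*-cancelʳ-≡ _ _ M {{M≢0}} (begin
    placements m μ * M             ≡⟨ placements*multFactProd m μ (sum μ) μ≤ ⟩
    (m C ℓ) * ℓ !                  ≡⟨ cong ((m C ℓ) *_) ℓ!≡ ⟨
    (m C ℓ) * (placements ℓ μ * M) ≡⟨ *-assoc (m C ℓ) (placements ℓ μ) M ⟨
    (m C ℓ) * placements ℓ μ * M   ≡⟨ cong (_* M) (*-comm (m C ℓ) (placements ℓ μ)) ⟩
    placements ℓ μ * (m C ℓ) * M   ≡⟨ cong (λ u → u * (m C ℓ) * M) multinomial≡ ⟨
    multinomial μ * (m C ℓ) * M    ∎))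
    where
    open ≡-Reasoning
    ℓ = length μ
    M = multFactProd (sum μ) μ
    M≢0 = multFactProd≢0 (sum μ) μ
    ℓ!≡ : placements ℓ μ * M ≡ ℓ !
    ℓ!≡ = trans (placements*multFactProd ℓ μ (sum μ) μ≤) (trans (cong (_* ℓ !) (nCn≡1 ℓ)) (+-identityʳ (ℓ !)))
    multinomial≡ : multinomial μ ≡ placements ℓ μ
    multinomial≡ = trans (cong (λ u → (u / M) {{M≢0}}) (sym ℓ!≡)) (m*n/n≡m (placements ℓ μ) M {{M≢0}})

module Coefficients {c ℓ : Level} (R : CommutativeRing c ℓ) (g : ℕ → CommutativeRing.Carrier R) where

  open import Data.Nat using (ℕ; zero; suc; _≤_; _<_; z≤n; s≤s; _∸_; _⊓_; _≟_; _<?_; _≤?_)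
    renaming (_+_ to _+ℕ_; _*_ to _*ℕ_)
  import Data.Nat.Properties as ℕ
  open import Data.Maybe using (nothing)
  open import Data.Nat.Combinatorics using (_C_; k>n⇒nCk≡0; nCk+nC[k+1]≡[n+1]C[k+1])
  open import Data.Nat.Induction using (<-rec)
  import Algebra.Properties.Semiring.Mult as SemiringMult
  open import Function using (_∘_)
  open import Data.Product using (_,_) renaming (_×_ to _×ₚ_)
  open import Data.Nat.ListAction using (sum)
  open import Data.List using (List; []; _∷_; _++_; map; concatMap; upTo; foldr)
  open import Data.List.Relation.Unary.All as All using (All; []; _∷_)
  open import Relation.Binary.PropositionalEquality as ≡ using (_≡_; _≢_)
  open import Relation.Nullary using (yes; no)
  open import Tactic.RingSolver.Core.AlmostCommutativeRing using (fromCommutativeRing)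
  import Tactic.RingSolver.NonReflective as NonReflective
  open Counting

  open CommutativeRing R
  open WithRing R
  open import Relation.Binary.Reasoning.Setoid setoid
  open NonReflective (fromCommutativeRing R (λ _ → nothing)) using (solve; _⊕_; _⊗_; _⊜_)
  open SemiringMult semiring using (_×_; ×-congʳ; ×-homo-+; ×-assoc-*; ×-comm-*; ×1-homo-*)

  infix 4 _≈ₚ_
  _≈ₚ_ : Poly → Poly → Set ℓ
  f ≈ₚ f′ = ∀ N → f N ≈ f′ N

  -- Truncated power series

  -- Reading Poly as power series in t: shift i f = tⁱ f, and conv c K f = (Σ_{i<K} c i tⁱ) f.
  shift : ℕ → Poly → Poly
  shift zero    f N       = f N
  shift (suc i) f zero    = 0#
  shift (suc i) f (suc N) = shift i f N

  shift-< : ∀ i f N → N < i → shift i f N ≡ 0#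
  shift-< (suc i) f zero    _         = ≡.refl
  shift-< (suc i) f (suc N) (s≤s N<i) = shift-< i f N N<i

  shift-+ : ∀ i f d → shift i f (i +ℕ d) ≡ f d
  shift-+ zero    f d = ≡.refl
  shift-+ (suc i) f d = shift-+ i f d

  shift-cong : ∀ i {f f′} N → (∀ d → i +ℕ d ≡ N → f d ≈ f′ d) → shift i f N ≈ shift i f′ N
  shift-cong zero    N       f≈f′ = f≈f′ N ≡.refl
  shift-cong (suc i) zero    f≈f′ = refl
  shift-cong (suc i) (suc N) f≈f′ = shift-cong i N (λ d e → f≈f′ d (≡.cong suc e))

  shift-0ₚ : ∀ i → shift i 0ₚ ≈ₚ 0ₚ
  shift-0ₚ zero    N       = refl
  shift-0ₚ (suc i) zero    = refl
  shift-0ₚ (suc i) (suc N) = shift-0ₚ i N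

  shift-+ₚ : ∀ i f f′ → shift i (f +ₚ f′) ≈ₚ shift i f +ₚ shift i f′
  shift-+ₚ zero    f f′ N       = refl
  shift-+ₚ (suc i) f f′ zero    = sym (+-identityˡ 0#)
  shift-+ₚ (suc i) f f′ (suc N) = shift-+ₚ i f f′ N

  shift-*ₛ : ∀ i u f → shift i (u *ₛ f) ≈ₚ u *ₛ shift i f
  shift-*ₛ zero    u f N       = refl
  shift-*ₛ (suc i) u f zero    = sym (zeroʳ u)
  shift-*ₛ (suc i) u f (suc N) = shift-*ₛ i u f N

  shift-shift : ∀ i j f N → shift i (shift j f) N ≡ shift (i +ℕ j) f N
  shift-shift zero    j f N       = ≡.refl
  shift-shift (suc i) j f zero    = ≡.refl
  shift-shift (suc i) j f (suc N) = shift-shift i j f N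

  shift-comm : ∀ i j f N → shift i (shift j f) N ≡ shift j (shift i f) N
  shift-comm i j f N = ≡.trans (shift-shift i j f N)
    (≡.trans (≡.cong (λ s → shift s f N) (ℕ.+-comm i j)) (≡.sym (shift-shift j i f N)))

  conv : Poly → ℕ → Poly → Poly
  conv c zero    f = 0ₚ
  conv c (suc K) f = conv c K f +ₚ (c K *ₛ shift K f)

  conv-cong : ∀ {c c′} K {f f′} N → (∀ i → i < K → c i ≈ c′ i) → (∀ j → j ≤ N → f j ≈ f′ j) →
              conv c K f N ≈ conv c′ K f′ N
  conv-cong zero    N c≈c′ f≈f′ = refl
  conv-cong (suc K) N c≈c′ f≈f′ = +-cong (conv-cong K N (λ i i<K → c≈c′ i (ℕ.m<n⇒m<1+n i<K)) f≈f′)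
    (*-cong (c≈c′ K ℕ.≤-refl) (shift-cong K N (λ d K+d≡N → f≈f′ d (≡.subst (d ≤_) K+d≡N (ℕ.m≤n+m d K)))))

  conv-vanishes : ∀ c K f N → (∀ j → j ≤ N → f j ≈ 0#) → conv c K f N ≈ 0#
  conv-vanishes c K f N f≈0 = begin
    conv c K f N  ≈⟨ conv-cong K N (λ _ _ → refl) f≈0 ⟩
    conv c K 0ₚ N ≈⟨ conv-0ₚ K ⟩
    0#            ∎
    where
    conv-0ₚ : ∀ K → conv c K 0ₚ N ≈ 0#
    conv-0ₚ zero    = refl
    conv-0ₚ (suc K) = trans (+-cong (conv-0ₚ K) (trans (*-congˡ (shift-0ₚ K N)) (zeroʳ (c K)))) (+-identityˡ 0#)

  conv-+ₚ : ∀ c K f f′ → conv c K (f +ₚ f′) ≈ₚ conv c K f +ₚ conv c K f′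
  conv-+ₚ c zero    f f′ N = sym (+-identityˡ 0#)
  conv-+ₚ c (suc K) f f′ N = begin
    conv c K (f +ₚ f′) N + c K * shift K (f +ₚ f′) N
      ≈⟨ +-cong (conv-+ₚ c K f f′ N) (*-congˡ (shift-+ₚ K f f′ N)) ⟩
    (conv c K f N + conv c K f′ N) + c K * (shift K f N + shift K f′ N)
      ≈⟨ solve 5 (λ a b u x y → ((a ⊕ b) ⊕ u ⊗ (x ⊕ y)) ⊜ ((a ⊕ u ⊗ x) ⊕ (b ⊕ u ⊗ y))) refl _ _ _ _ _ ⟩
    (conv c K f N + c K * shift K f N) + (conv c K f′ N + c K * shift K f′ N) ∎

  conv-*ₛ : ∀ c K u f → conv c K (u *ₛ f) ≈ₚ u *ₛ conv c K f
  conv-*ₛ c zero    u f N = sym (zeroʳ u)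
  conv-*ₛ c (suc K) u f N = begin
    conv c K (u *ₛ f) N + c K * shift K (u *ₛ f) N
      ≈⟨ +-cong (conv-*ₛ c K u f N) (*-congˡ (shift-*ₛ K u f N)) ⟩
    u * conv c K f N + c K * (u * shift K f N)
      ≈⟨ solve 4 (λ u a v x → (u ⊗ a ⊕ v ⊗ (u ⊗ x)) ⊜ (u ⊗ (a ⊕ v ⊗ x))) refl _ _ _ _ ⟩
    u * (conv c K f N + c K * shift K f N) ∎

  conv-shift : ∀ c K i f → conv c K (shift i f) ≈ₚ shift i (conv c K f)
  conv-shift c zero    i f N = sym (shift-0ₚ i N)
  conv-shift c (suc K) i f N = begin
    conv c K (shift i f) N + c K * shift K (shift i f) N
      ≈⟨ +-cong (conv-shift c K i f N) (*-congˡ (reflexive (shift-comm K i f N))) ⟩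
    shift i (conv c K f) N + c K * shift i (shift K f) N
      ≈⟨ +-congˡ (shift-*ₛ i (c K) (shift K f) N) ⟨
    shift i (conv c K f) N + shift i (c K *ₛ shift K f) N
      ≈⟨ shift-+ₚ i (conv c K f) (c K *ₛ shift K f) N ⟨
    shift i (conv c (suc K) f) N ∎

  conv-saturates : ∀ c K f N → N < K → conv c K f N ≈ conv c (suc N) f N
  conv-saturates c (suc K) f N (s≤s N≤K) with N ≟ K
  ... | yes ≡.refl = refl
  ... | no N≢K = begin
    conv c K f N + c K * shift K f N ≈⟨ +-congˡ (*-congˡ (reflexive (shift-< K f N N<K))) ⟩
    conv c K f N + c K * 0#          ≈⟨ trans (+-congˡ (zeroʳ (c K))) (+-identityʳ _) ⟩
    conv c K f N                     ≈⟨ conv-saturates c K f N N<K ⟩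
    conv c (suc N) f N               ∎
    where N<K = ℕ.≤∧≢⇒< N≤K N≢K

  conv-suc : ∀ c K f N → conv c (suc K) f (suc N) ≈ c 0 * f (suc N) + conv (c ∘ suc) K f N
  conv-suc c zero    f N = trans (+-identityˡ _) (sym (+-identityʳ _))
  conv-suc c (suc K) f N = trans (+-congʳ (conv-suc c K f N)) (+-assoc _ _ _)

  -- mulG k multiplies by G_k = Σ_{i<k} g(i+1) tⁱ, and powG k m = G_kᵐ.
  mulG : ℕ → Poly → Poly
  mulG = conv (g ∘ suc)

  powG : ℕ → ℕ → Poly
  powG k zero    = 1ₚ
  powG k (suc m) = mulG k (powG k m)

  powG-1 : g 1 ≈ 1# → ∀ m → powG 1 m ≈ₚ 1ₚ
  powG-1 g1≈1 zero    N = refl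
  powG-1 g1≈1 (suc m) N = trans (+-identityˡ _) (trans (*-cong g1≈1 (powG-1 g1≈1 m N)) (*-identityˡ _))

  weightedSum≈conv : ∀ n o m → weightedSum g o (Ps g n) m ≈ conv (λ i → g (suc (o +ℕ i))) (suc n) (λ j → A g j m) n
  weightedSum≈conv zero    o m =
    trans (+-comm _ _) (+-congˡ (*-congʳ (reflexive (≡.cong (g ∘ suc) (≡.sym (ℕ.+-identityʳ o))))))
  weightedSum≈conv (suc n) o m = begin
    g (suc o) * A g (suc n) m + weightedSum g (suc o) (Ps g n) m
      ≈⟨ +-congˡ (weightedSum≈conv n (suc o) m) ⟩
    g (suc o) * A g (suc n) m + conv (λ i → g (suc (suc o +ℕ i))) (suc n) (λ j → A g j m) n
      ≈⟨ +-cong (*-congʳ (reflexive (≡.cong (g ∘ suc) (≡.sym (ℕ.+-identityʳ o)))))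
                (conv-cong (suc n) n (λ i _ → reflexive (≡.cong (g ∘ suc) (≡.sym (ℕ.+-suc o i)))) (λ _ _ → refl)) ⟩
    g (suc (o +ℕ 0)) * A g (suc n) m + conv (λ i → g (suc (o +ℕ suc i))) (suc n) (λ j → A g j m) n
      ≈⟨ conv-suc (λ i → g (suc (o +ℕ i))) (suc n) (λ j → A g j m) n ⟨
    conv (λ i → g (suc (o +ℕ i))) (suc (suc n)) (λ j → A g j m) (suc n) ∎

  A-below : ∀ m n → n < m → A g n m ≈ 0#
  A-below (suc m) zero    _         = refl
  A-below (suc m) (suc n) (s≤s n<m) = trans (weightedSum≈conv n 0 m)
    (conv-vanishes _ (suc n) _ n (λ j j≤n → A-below m j (ℕ.≤-<-trans j≤n n<m)))

  A≈powG : ∀ m N L → N < L → A g (m +ℕ N) m ≈ powG L m N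
  A≈powG zero    zero    L _   = refl
  A≈powG zero    (suc N) L _   = refl
  A≈powG (suc m) N       L N<L = begin
    A g (suc (m +ℕ N)) (suc m)                         ≈⟨ weightedSum≈conv (m +ℕ N) 0 m ⟩
    mulG (suc (m +ℕ N)) (λ j → A g j m) (m +ℕ N)       ≈⟨ conv-cong (suc (m +ℕ N)) (m +ℕ N) (λ _ _ → refl) A≈shift ⟩
    mulG (suc (m +ℕ N)) (shift m (powG L m)) (m +ℕ N)  ≈⟨ conv-shift (g ∘ suc) (suc (m +ℕ N)) m (powG L m) (m +ℕ N) ⟩
    shift m (mulG (suc (m +ℕ N)) (powG L m)) (m +ℕ N)  ≡⟨ shift-+ m _ N ⟩
    mulG (suc (m +ℕ N)) (powG L m) N                   ≈⟨ conv-saturates _ (suc (m +ℕ N)) _ N (s≤s (ℕ.m≤n+m N m)) ⟩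
    mulG (suc N) (powG L m) N                          ≈⟨ conv-saturates _ L _ N N<L ⟨
    powG L (suc m) N                                   ∎
    where
    A≈shift : ∀ j → j ≤ m +ℕ N → A g j m ≈ shift m (powG L m) j
    A≈shift j j≤m+N with j <? m
    ... | yes j<m = trans (A-below m j j<m) (reflexive (≡.sym (shift-< m (powG L m) j j<m)))
    ... | no j≮m = ≡.subst (λ t → A g t m ≈ shift m (powG L m) t) (ℕ.m+[n∸m]≡n m≤j)
        (trans (A≈powG m (j ∸ m) L (ℕ.≤-<-trans j∸m≤N N<L)) (reflexive (≡.sym (shift-+ m (powG L m) (j ∸ m)))))
      where
      m≤j = ℕ.≮⇒≥ j≮m
      j∸m≤N : j ∸ m ≤ N
      j∸m≤N = ≡.subst (j ∸ m ≤_) (ℕ.m+n∸m≡n m N) (ℕ.∸-monoˡ-≤ m j≤m+N)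

  -- Sums over partitions

  sumOver : (List ℕ → Carrier) → List (List ℕ) → Carrier
  sumOver φ = foldr (λ ν r → φ ν + r) 0#

  sumOver-++ : ∀ φ L L′ → sumOver φ (L ++ L′) ≈ sumOver φ L + sumOver φ L′
  sumOver-++ φ []      L′ = sym (+-identityˡ _)
  sumOver-++ φ (ν ∷ L) L′ = trans (+-congˡ (sumOver-++ φ L L′)) (sym (+-assoc _ _ _))

  sumOver-map : ∀ φ f L → sumOver φ (map f L) ≡ sumOver (φ ∘ f) L
  sumOver-map φ f []      = ≡.refl
  sumOver-map φ f (ν ∷ L) = ≡.cong (φ (f ν) +_) (sumOver-map φ f L)

  sumOver-congᴬ : ∀ {φ ψ} L → All (λ ν → φ ν ≈ ψ ν) L → sumOver φ L ≈ sumOver ψ L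
  sumOver-congᴬ []      []          = refl
  sumOver-congᴬ (ν ∷ L) (φ≈ψ ∷ φ≈ψs) = +-cong φ≈ψ (sumOver-congᴬ L φ≈ψs)

  sumOver-cong : ∀ {φ ψ} L → (∀ ν → φ ν ≈ ψ ν) → sumOver φ L ≈ sumOver ψ L
  sumOver-cong L φ≈ψ = sumOver-congᴬ L (All.universal φ≈ψ L)

  sumOver-*ₗ : ∀ u φ L → sumOver (λ ν → u * φ ν) L ≈ u * sumOver φ L
  sumOver-*ₗ u φ []      = sym (zeroʳ u)
  sumOver-*ₗ u φ (ν ∷ L) = trans (+-congˡ (sumOver-*ₗ u φ L)) (sym (distribˡ u _ _))

  sumBelow : ℕ → (ℕ → Carrier) → Carrier
  sumBelow zero    T = 0#
  sumBelow (suc n) T = sumBelow n T + T n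

  sumBelow-cong : ∀ n {T T′} → (∀ j → j < n → T j ≈ T′ j) → sumBelow n T ≈ sumBelow n T′
  sumBelow-cong zero    T≈T′ = refl
  sumBelow-cong (suc n) T≈T′ = +-cong (sumBelow-cong n (λ j j<n → T≈T′ j (ℕ.m<n⇒m<1+n j<n))) (T≈T′ n ℕ.≤-refl)

  sumBelow-*ₗ : ∀ n u T → sumBelow n (λ j → u * T j) ≈ u * sumBelow n T
  sumBelow-*ₗ zero    u T = sym (zeroʳ u)
  sumBelow-*ₗ (suc n) u T = trans (+-congʳ (sumBelow-*ₗ n u T)) (sym (distribˡ u _ _))

  sumOver-concatMap-upTo : ∀ φ (F : ℕ → List (List ℕ)) n →
    sumOver φ (concatMap F (map suc (upTo n))) ≈ sumBelow n (λ j → sumOver φ (F (suc j)))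
  sumOver-concatMap-upTo φ F zero    = refl
  sumOver-concatMap-upTo φ F (suc n) = begin
    sumOver φ (concatMap F (map suc (upTo (suc n))))
      ≡⟨ ≡.cong (sumOver φ) (concatMap-upTo-suc F n) ⟩
    sumOver φ (concatMap F (map suc (upTo n)) ++ F (suc n))
      ≈⟨ sumOver-++ φ (concatMap F (map suc (upTo n))) (F (suc n)) ⟩
    sumOver φ (concatMap F (map suc (upTo n))) + sumOver φ (F (suc n))
      ≈⟨ +-congʳ (sumOver-concatMap-upTo φ F n) ⟩
    sumBelow (suc n) (λ j → sumOver φ (F (suc j))) ∎

  sumOver-partitionsGo-suc : ∀ φ f k N → sumOver φ (partitionsGo (suc f) k (suc N)) ≈
    sumBelow (k ⊓ suc N) (λ j → sumOver (λ ν → φ (suc j ∷ ν)) (partitionsGo f (suc j) (N ∸ j)))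
  sumOver-partitionsGo-suc φ f k N =
    trans (sumOver-concatMap-upTo φ (λ j → map (j ∷_) (partitionsGo f j (suc N ∸ j))) (k ⊓ suc N))
          (sumBelow-cong (k ⊓ suc N) (λ j _ → reflexive (sumOver-map φ (suc j ∷_) (partitionsGo f (suc j) (N ∸ j)))))

  fromℕ : ℕ → Carrier
  fromℕ n = n × 1#

  ·≡× : ∀ n x → n · x ≡ n × x
  ·≡× zero    x = ≡.refl
  ·≡× (suc n) x = ≡.cong (x +_) (·≡× n x)

  ·≈fromℕ* : ∀ n x → n · x ≈ fromℕ n * x
  ·≈fromℕ* n x = begin
    n · x         ≡⟨ ·≡× n x ⟩
    n × x         ≈⟨ ×-congʳ n (*-identityˡ x) ⟨
    n × (1# * x)  ≈⟨ ×-assoc-* n 1# x ⟨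
    fromℕ n * x   ∎

  ·-*ℕ : ∀ p q x → (p *ℕ q) · x ≈ fromℕ p * (q · x)
  ·-*ℕ p q x = begin
    (p *ℕ q) · x               ≈⟨ ·≈fromℕ* (p *ℕ q) x ⟩
    fromℕ (p *ℕ q) * x         ≈⟨ *-congʳ (×1-homo-* p q) ⟩
    fromℕ p * fromℕ q * x      ≈⟨ *-assoc _ _ _ ⟩
    fromℕ p * (fromℕ q * x)    ≈⟨ *-congˡ (·≈fromℕ* q x) ⟨
    fromℕ p * (q · x)          ∎

  ·-*ₗ : ∀ q u x → q · (u * x) ≈ u * (q · x)
  ·-*ₗ q u x = begin
    q · (u * x)  ≡⟨ ·≡× q (u * x) ⟩
    q × (u * x)  ≈⟨ ×-comm-* q u x ⟨
    u * (q × x)  ≡⟨ ≡.cong (u *_) (·≡× q x) ⟨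
    u * (q · x)  ∎

  partitionSum : ℕ → ℕ → ℕ → Carrier
  partitionSum k m N = sumOver (λ ν → placements m ν · 𝒢 g ν) (partitionsGo N k N)

  runPartitionSum : ℕ → ℕ → ℕ → ℕ → Carrier
  runPartitionSum k m a N = sumOver (λ ν → placementsRun m a k ν · 𝒢 g ν) (partitionsGo N k N)

  sumOver-placementsRun-≢ : ∀ m a x y L → y ≢ x →
    sumOver (λ ν → placementsRun m a x (y ∷ ν) · 𝒢 g (y ∷ ν)) L ≈
    fromℕ (m C a) * sumOver (λ ν → placements (m ∸ a) (y ∷ ν) · 𝒢 g (y ∷ ν)) L
  sumOver-placementsRun-≢ m a x y L y≢x = trans
    (sumOver-cong L λ ν → trans (reflexive (≡.cong (_· 𝒢 g (y ∷ ν)) (placementsRun-≢ m a x y ν y≢x)))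
                                (·-*ℕ (m C a) _ _))
    (sumOver-*ₗ (fromℕ (m C a)) _ L)

  sumOver-placementsRun-≡ : ∀ m a x L →
    sumOver (λ ν → placementsRun m a x (x ∷ ν) · 𝒢 g (x ∷ ν)) L ≈
    g (suc x) * sumOver (λ ν → placementsRun m (suc a) x ν · 𝒢 g ν) L
  sumOver-placementsRun-≡ m a x L = trans
    (sumOver-cong L λ ν → trans (reflexive (≡.cong (_· 𝒢 g (x ∷ ν)) (placementsRun-≡ m a x ν)))
                                (·-*ₗ (placementsRun m (suc a) x ν) _ _))
    (sumOver-*ₗ (g (suc x)) _ L)

  -- Splitting off the first (largest) part: either it is smaller than k, which closes the
  -- current run, or it is one more copy of k.
  module _ (k′ m a N′ : ℕ) where
    private
      k = suc k′
      h = g (suc k)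

      firstPartSum : (ℕ → List ℕ → ℕ) → ℕ → Carrier
      firstPartSum count j = sumOver (λ ν → count j ν · 𝒢 g (suc j ∷ ν)) (partitionsGo N′ (suc j) (N′ ∸ j))

      T T′ : ℕ → Carrier
      T  = firstPartSum (λ j ν → placementsRun m a k (suc j ∷ ν))
      T′ = firstPartSum (λ j ν → placements (m ∸ a) (suc j ∷ ν))

      runPartitionSum-split : runPartitionSum k m a (suc N′) ≈ sumBelow (k ⊓ suc N′) T
      runPartitionSum-split = sumOver-partitionsGo-suc _ N′ k N′

      partitionSum-split : partitionSum k′ (m ∸ a) (suc N′) ≈ sumBelow (k′ ⊓ suc N′) T′
      partitionSum-split = sumOver-partitionsGo-suc _ N′ k′ N′

      sumBelow-T<k : ∀ r → r ≤ k′ → sumBelow r T ≈ fromℕ (m C a) * sumBelow r T′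
      sumBelow-T<k r r≤k′ = trans
        (sumBelow-cong r λ j j<r → sumOver-placementsRun-≢ m a k (suc j) (partitionsGo N′ (suc j) (N′ ∸ j))
          λ j≡k′ → ℕ.<-irrefl (ℕ.suc-injective j≡k′) (ℕ.<-≤-trans j<r r≤k′))
        (sumBelow-*ₗ r (fromℕ (m C a)) T′)

      T-k : T k′ ≈ h * runPartitionSum k m (suc a) (N′ ∸ k′)
      T-k = trans (sumOver-placementsRun-≡ m a k (partitionsGo N′ k (N′ ∸ k′)))
        (*-congˡ (reflexive (≡.cong (sumOver _)
          (partitionsGo-fuel N′ (N′ ∸ k′) k (N′ ∸ k′) (ℕ.m∸n≤m N′ k′) ℕ.≤-refl))))

    runPartitionSum-suc-≥ : k′ ≤ N′ → runPartitionSum k m a (suc N′) ≈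
      fromℕ (m C a) * partitionSum k′ (m ∸ a) (suc N′) + h * shift k (runPartitionSum k m (suc a)) (suc N′)
    runPartitionSum-suc-≥ k′≤N′ = begin
      runPartitionSum k m a (suc N′)             ≈⟨ runPartitionSum-split ⟩
      sumBelow (k ⊓ suc N′) T                    ≡⟨ ≡.cong (λ r → sumBelow r T) (≡.cong suc (ℕ.m≤n⇒m⊓n≡m k′≤N′)) ⟩
      sumBelow k′ T + T k′                       ≈⟨ +-cong (sumBelow-T<k k′ ℕ.≤-refl) T-k ⟩
      fromℕ (m C a) * sumBelow k′ T′ + h * runPartitionSum k m (suc a) (N′ ∸ k′)
        ≡⟨ ≡.cong₂ (λ r s → fromℕ (m C a) * sumBelow r T′ + h * s)
                   (≡.sym (ℕ.m≤n⇒m⊓n≡m (ℕ.m≤n⇒m≤1+n k′≤N′)))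
                   (≡.trans (≡.sym (shift-+ k′ _ (N′ ∸ k′))) (≡.cong (shift k′ _) (ℕ.m+[n∸m]≡n k′≤N′))) ⟩
      fromℕ (m C a) * sumBelow (k′ ⊓ suc N′) T′ + h * shift k (runPartitionSum k m (suc a)) (suc N′)
        ≈⟨ +-congʳ (*-congˡ partitionSum-split) ⟨
      fromℕ (m C a) * partitionSum k′ (m ∸ a) (suc N′) + h * shift k (runPartitionSum k m (suc a)) (suc N′) ∎

    runPartitionSum-suc-< : N′ < k′ → runPartitionSum k m a (suc N′) ≈
      fromℕ (m C a) * partitionSum k′ (m ∸ a) (suc N′) + h * shift k (runPartitionSum k m (suc a)) (suc N′)
    runPartitionSum-suc-< N′<k′ = begin
      runPartitionSum k m a (suc N′)             ≈⟨ runPartitionSum-split ⟩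
      sumBelow (k ⊓ suc N′) T                    ≡⟨ ≡.cong (λ r → sumBelow r T) (≡.cong suc (ℕ.m≥n⇒m⊓n≡n (ℕ.<⇒≤ N′<k′))) ⟩
      sumBelow (suc N′) T                        ≈⟨ sumBelow-T<k (suc N′) N′<k′ ⟩
      fromℕ (m C a) * sumBelow (suc N′) T′       ≡⟨ ≡.cong (λ r → fromℕ (m C a) * sumBelow r T′) (≡.sym (ℕ.m≥n⇒m⊓n≡n N′<k′)) ⟩
      fromℕ (m C a) * sumBelow (k′ ⊓ suc N′) T′  ≈⟨ *-congˡ partitionSum-split ⟨
      fromℕ (m C a) * partitionSum k′ (m ∸ a) (suc N′)
        ≈⟨ +-identityʳ _ ⟨
      fromℕ (m C a) * partitionSum k′ (m ∸ a) (suc N′) + 0#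
        ≈⟨ +-congˡ (trans (*-congˡ (reflexive (shift-< k′ _ N′ N′<k′))) (zeroʳ h)) ⟨
      fromℕ (m C a) * partitionSum k′ (m ∸ a) (suc N′) + h * shift k (runPartitionSum k m (suc a)) (suc N′) ∎

  runPartitionSum-rec : ∀ k′ m a N → runPartitionSum (suc k′) m a N ≈
    fromℕ (m C a) * partitionSum k′ (m ∸ a) N + g (suc (suc k′)) * shift (suc k′) (runPartitionSum (suc k′) m (suc a)) N
  runPartitionSum-rec k′ m a zero = begin
    (m C a) · 1# + 0#                 ≈⟨ +-identityʳ _ ⟩
    (m C a) · 1#                      ≈⟨ ·≈fromℕ* (m C a) 1# ⟩
    fromℕ (m C a) * 1#                ≈⟨ *-congˡ (trans (+-identityʳ _) (+-identityʳ _)) ⟨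
    fromℕ (m C a) * ((1# + 0#) + 0#)  ≈⟨ trans (+-congˡ (zeroʳ _)) (+-identityʳ _) ⟨
    fromℕ (m C a) * ((1# + 0#) + 0#) + g (suc (suc k′)) * 0# ∎
  runPartitionSum-rec k′ m a (suc N′) with k′ ≤? N′
  ... | yes k′≤N′ = runPartitionSum-suc-≥ k′ m a N′ k′≤N′
  ... | no  k′≰N′ = runPartitionSum-suc-< k′ m a N′ (ℕ.≰⇒> k′≰N′)

  -- Any X obeying the recurrence of runPartitionSum satisfies
  -- X m a = Σ_{b ≥ a} (m C b) (h tᵏ)^{b−a} G_k^{m−b}; so X m 0 = (G_k + h tᵏ)ᵐ = G_{k+1}ᵐ, proved through Pascal's rule by induction on m.
  module BinomialStep (k′ : ℕ) (X : ℕ → ℕ → Poly)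
    (X-rec : ∀ m a N →
      X m a N ≈ fromℕ (m C a) * powG (suc k′) (m ∸ a) N + g (suc (suc k′)) * shift (suc k′) (X m (suc a)) N)
    where
    private
      k = suc k′
      h = g (suc k)

      d<N : ∀ d N → k +ℕ d ≡ N → d < N
      d<N d N k+d≡N = ≡.subst (d <_) k+d≡N (s≤s (ℕ.m≤n+m d k′))

    X-vanishes : ∀ N m a → m < a → X m a N ≈ 0#
    X-vanishes = <-rec _ λ N rec m a m<a → begin
      X m a N                                            ≈⟨ X-rec m a N ⟩
      fromℕ (m C a) * powG k (m ∸ a) N + h * shift k (X m (suc a)) N
        ≈⟨ +-cong (*-congʳ (reflexive (≡.cong fromℕ (k>n⇒nCk≡0 m<a))))
                  (*-congˡ (trans (shift-cong k N λ d e → rec (d<N d N e) m (suc a) (ℕ.m<n⇒m<1+n m<a)) (shift-0ₚ k N))) ⟩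
      0# * powG k (m ∸ a) N + h * 0#                     ≈⟨ trans (+-cong (zeroˡ _) (zeroʳ _)) (+-identityˡ 0#) ⟩
      0#                                                 ∎

    pascalTerm : ℕ → ℕ → Poly
    pascalTerm m zero    N = 0#
    pascalTerm m (suc a) N = fromℕ (m C a) * powG k (m ∸ a) N

    pascal : ∀ m a N → fromℕ (suc m C a) * powG k (suc m ∸ a) N ≈
                       fromℕ (m C a) * powG k (suc (m ∸ a)) N + pascalTerm m a N
    pascal m zero     N = sym (+-identityʳ _)
    pascal m (suc a′) N = begin
      fromℕ (suc m C suc a′) * powG k (m ∸ a′) N
        ≈⟨ *-congʳ (reflexive (≡.cong fromℕ (≡.sym (nCk+nC[k+1]≡[n+1]C[k+1] m a′)))) ⟩
      fromℕ (m C a′ +ℕ m C suc a′) * powG k (m ∸ a′) N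
        ≈⟨ *-congʳ (×-homo-+ 1# (m C a′) (m C suc a′)) ⟩
      (fromℕ (m C a′) + fromℕ (m C suc a′)) * powG k (m ∸ a′) N
        ≈⟨ trans (distribʳ _ _ _) (+-comm _ _) ⟩
      fromℕ (m C suc a′) * powG k (m ∸ a′) N + fromℕ (m C a′) * powG k (m ∸ a′) N
        ≈⟨ +-congʳ vanishing-or-equal ⟩
      fromℕ (m C suc a′) * powG k (suc (m ∸ suc a′)) N + fromℕ (m C a′) * powG k (m ∸ a′) N ∎
      where
      vanishing-or-equal : fromℕ (m C suc a′) * powG k (m ∸ a′) N ≈ fromℕ (m C suc a′) * powG k (suc (m ∸ suc a′)) N
      vanishing-or-equal with suc a′ ≤? m
      ... | yes a′<m = reflexive (≡.cong (λ t → fromℕ (m C suc a′) * powG k t N) (ℕ.+-∸-assoc 1 a′<m))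
      ... | no a′≮m rewrite k>n⇒nCk≡0 (ℕ.≰⇒> a′≮m) = trans (zeroˡ _) (sym (zeroˡ _))

    X-suc : ∀ N m a → X (suc m) a N ≈ mulG (suc k) (X m a) N + pascalTerm m a N
    X-suc = <-rec _ λ N rec m a →
      let c = fromℕ (m C a); p = powG k (m ∸ a); Y = X m (suc a) in begin
      X (suc m) a N                                                   ≈⟨ X-rec (suc m) a N ⟩
      fromℕ (suc m C a) * powG k (suc m ∸ a) N + h * shift k (X (suc m) (suc a)) N
        ≈⟨ +-cong (pascal m a N) (*-congˡ (shift-cong k N λ d e → rec (d<N d N e) m (suc a))) ⟩
      (c * mulG k p N + pascalTerm m a N) + h * shift k (mulG (suc k) Y +ₚ (c *ₛ p)) N
        ≈⟨ +-congˡ (*-congˡ (trans (shift-+ₚ k _ _ N) (+-congˡ (shift-*ₛ k c p N)))) ⟩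
      (c * mulG k p N + pascalTerm m a N) + h * (shift k (mulG (suc k) Y) N + c * shift k p N)
        ≈⟨ solve 6 (λ c p b h s q → ((c ⊗ p ⊕ b) ⊕ h ⊗ (s ⊕ c ⊗ q)) ⊜ ((c ⊗ (p ⊕ h ⊗ q) ⊕ h ⊗ s) ⊕ b))
                   refl _ _ _ _ _ _ ⟩
      (c * (mulG k p N + h * shift k p N) + h * shift k (mulG (suc k) Y) N) + pascalTerm m a N
        -- mulG (suc k) = mulG k + h tᵏ holds by definition
        ≈⟨ +-congʳ (+-congˡ (*-congˡ (conv-shift (g ∘ suc) (suc k) k Y N))) ⟨
      (c * mulG (suc k) p N + h * mulG (suc k) (shift k Y) N) + pascalTerm m a N
        ≈⟨ +-congʳ (+-cong (conv-*ₛ _ (suc k) c p N) (conv-*ₛ _ (suc k) h (shift k Y) N)) ⟨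
      (mulG (suc k) (c *ₛ p) N + mulG (suc k) (h *ₛ shift k Y) N) + pascalTerm m a N
        ≈⟨ +-congʳ (conv-+ₚ _ (suc k) _ _ N) ⟨
      mulG (suc k) ((c *ₛ p) +ₚ (h *ₛ shift k Y)) N + pascalTerm m a N
        ≈⟨ +-congʳ (conv-cong (suc k) N (λ _ _ → refl) (λ j _ → X-rec m a j)) ⟨
      mulG (suc k) (X m a) N + pascalTerm m a N                       ∎

    X-0≈powG : ∀ m N → X m 0 N ≈ powG (suc k) m N
    X-0≈powG zero    N = begin
      X 0 0 N                                    ≈⟨ X-rec 0 0 N ⟩
      fromℕ 1 * powG k 0 N + h * shift k (X 0 1) N
        ≈⟨ +-cong (*-congʳ (+-identityʳ 1#))
                  (*-congˡ (trans (shift-cong k N λ d _ → X-vanishes d 0 1 (s≤s z≤n)) (shift-0ₚ k N))) ⟩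
      1# * 1ₚ N + h * 0#                         ≈⟨ trans (+-cong (*-identityˡ _) (zeroʳ _)) (+-identityʳ _) ⟩
      1ₚ N                                       ∎
    X-0≈powG (suc m) N = trans (X-suc N m 0)
      (trans (+-identityʳ _) (conv-cong (suc k) N (λ _ _ → refl) (λ j _ → X-0≈powG m j)))

  partitionSum≈powG : g 1 ≈ 1# → ∀ k m N → partitionSum k m N ≈ powG (suc k) m N
  partitionSum≈powG g1≈1 zero m zero    = trans (+-identityʳ _) (trans (+-identityʳ 1#) (sym (powG-1 g1≈1 m 0)))
  partitionSum≈powG g1≈1 zero m (suc N) = sym (powG-1 g1≈1 m (suc N))
  partitionSum≈powG g1≈1 (suc k′) m N = begin
    partitionSum (suc k′) m N
      ≈⟨ sumOver-cong (partitionsGo N (suc k′) N) (λ ν → reflexive (≡.cong (_· 𝒢 g ν) (≡.sym (placementsRun-0 m (suc k′) ν)))) ⟩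
    runPartitionSum (suc k′) m 0 N ≈⟨ BinomialStep.X-0≈powG k′ (runPartitionSum (suc k′)) X-rec m N ⟩
    powG (suc (suc k′)) m N        ∎
    where
    X-rec : ∀ m a N → runPartitionSum (suc k′) m a N ≈
      fromℕ (m C a) * powG (suc k′) (m ∸ a) N + g (suc (suc k′)) * shift (suc k′) (runPartitionSum (suc k′) m (suc a)) N
    X-rec m a N = trans (runPartitionSum-rec k′ m a N) (+-congʳ (*-congˡ (partitionSum≈powG g1≈1 k′ (m ∸ a) N)))

  A≈RHS : g 1 ≈ 1# → ∀ n m → m ≤ n → A g n m ≈ RHS g n m
  A≈RHS g1≈1 n m m≤n = begin
    A g n m               ≡⟨ ≡.cong (λ t → A g t m) (≡.sym (ℕ.m+[n∸m]≡n m≤n)) ⟩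
    A g (m +ℕ N) m        ≈⟨ A≈powG m N (suc N) (ℕ.n<1+n N) ⟩
    powG (suc N) m N      ≈⟨ partitionSum≈powG g1≈1 N m N ⟨
    partitionSum N m N    ≈⟨ sumOver-congᴬ (partitionsGo N N N) (All.map placements≡ (partitionsGo-sound N N N)) ⟩
    RHS g n m             ∎
    where
    N = n ∸ m
    placements≡ : ∀ {μ} → NonIncreasing≤ N μ ×ₚ sum μ ≡ N → placements m μ · 𝒢 g μ ≈ term g n μ
    placements≡ {μ} (μ≤N , Σμ≡N) = reflexive (≡.cong (_· 𝒢 g μ) (≡.trans
      (≡.sym (multinomial*C≡placements m μ (≡.subst (λ t → NonIncreasing≤ t μ) (≡.sym Σμ≡N) μ≤N)))
      (≡.cong (λ t → multinomial μ *ℕ (t C len μ))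
              (≡.sym (≡.trans (≡.cong (n ∸_) Σμ≡N) (ℕ.m∸[m∸n]≡n m≤n))))))

-- The identity holds for every m ≤ n.
theorem1 : ∀ {c ℓ : Level} (R : CommutativeRing c ℓ) (g : ℕ → CommutativeRing.Carrier R) →
           CommutativeRing._≈_ R (g 1) (CommutativeRing.1# R) →
           ∀ (n m : ℕ) → 1 ≤ m → m < n →
           CommutativeRing._≈_ R (WithRing.A R g n m) (WithRing.RHS R g n m)
theorem1 R g g1≈1 n m _ m<n = Coefficients.A≈RHS R g g1≈1 n m (<⇒≤ m<n)
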